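{- For every positive integer $n$ with $n\equiv 2$ or $n\equiv 3 \pmod 4$, we have $Q(n)\equiv 0\pmod 4$.
   Context: For a positive integer $N$ write $[N]=\{1,\dots,N\}$. An $n$-queens configuration is a set $Q\subseteq[n]\times[n]$ with $|Q|=n$ such that no two distinct elements of $Q$ share a row (same first coordinate), a column (same second coordinate), a diagonal (same value of $j-i$), or an anti-diagonal (same value of $i+j$). $Q(n)$ denotes the number of $n$-queens configurations. -}

module Defs where

open import Data.Nat using (ℕ; zero; suc; _+_; _≟_)
open import Data.Nat.Properties using ()
open import Data.Product using (_×_; _,_; proj₁; proj₂)
open import Data.List using (List; []; _∷_; map; concatMap; length; filter; _++_)
open import Data.List.Relation.Unary.AllPairs using (AllPairs; allPairs?)
open import Relation.Nullary using (¬_; Dec; yes; no)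
open import Relation.Nullary.Decidable using (_×-dec_; ¬?)
open import Relation.Binary.PropositionalEquality using (_≡_)
open import Relation.Unary using (Decidable)

range : ℕ → List ℕ
range zero    = []
range (suc n) = range n ++ (suc n ∷ [])

-- a cell (i , j) of the board; i = row, j = column
Cell : Set
Cell = ℕ × ℕ

board : ℕ → List Cell
board n = concatMap (λ i → map (λ j → (i , j)) (range n)) (range n)

-- all subsets of a list (as sublists; the board list has no duplicates,
-- so these are exactly the subsets of [n] × [n], each listed once)
subsets : {A : Set} → List A → List (List A)
subsets []       = [] ∷ []
subsets (x ∷ xs) = let r = subsets xs in r ++ map (x ∷_) r

-- two distinct cells do not attack each other: different row, column,
-- diagonal (j - i) and anti-diagonal (i + j).  Diagonal j - i = j' - i'
-- is expressed without subtraction as j + i' = j' + i.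
NonAttacking : Cell → Cell → Set
NonAttacking (i , j) (i' , j') =
  (¬ i ≡ i') × (¬ j ≡ j') × (¬ (j + i') ≡ (j' + i)) × (¬ (i + j) ≡ (i' + j'))

nonAttacking? : (c d : Cell) → Dec (NonAttacking c d)
nonAttacking? (i , j) (i' , j') =
  ¬? (i ≟ i') ×-dec ¬? (j ≟ j') ×-dec ¬? ((j + i') ≟ (j' + i)) ×-dec ¬? ((i + j) ≟ (i' + j'))

IsQueens : ℕ → List Cell → Set
IsQueens n S = (length S ≡ n) × AllPairs NonAttacking S

isQueens? : (n : ℕ) → Decidable (IsQueens n)
isQueens? n S = (length S ≟ n) ×-dec allPairs? nonAttacking? S

Q : ℕ → ℕ
Q n = length (filter (isQueens? n) (subsets (board n)))

{-# OPTIONS --safe #-}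

-- Let V, H and D be the reflections of the board in its vertical axis, its horizontal axis and its
-- main diagonal.  For n ≥ 2 none of them fixes a queens configuration: every queen would have to
-- lie on the axis, but the axis is a line and two queens on a line attack each other.  On the
-- configurations that are not invariant under the half-turn VH, the Klein group {1, V, H, VH} thus
-- acts freely.  On the half-turn-invariant ones V and D commute, and VD is the quarter-turn.  A set
-- of cells invariant under the quarter-turn consists of 4-cycles and possibly the central cell, so
-- its size is 0 or 1 mod 4; hence for n ≡ 2, 3 (mod 4) the Klein group {1, V, D, VD} acts freely
-- there too.  All orbits therefore have 4 elements.

module Submission where

open import Defs

open import Level using (0ℓ)
open import Function.Base using (_∘_; id)
open import Function.Bundles using (Equivalence; mk⇔)
open import Data.Nat using (ℕ; zero; suc; _+_; _*_; _∸_; _≤_; _<_; _>_; z≤n; s≤s; _%_; _≟_)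
open import Data.Nat.Properties
  using (+-suc; +-comm; +-identityʳ; +-cancelˡ-≡; *-cancelˡ-≡; m∸n+n≡m; m∸[m∸n]≡n; m∸n≤m;
         m<n⇒0<n∸m; m≤n⇒m≤1+n; m≤n⇒m<n∨m≡n; 1+n≰n; ≤-refl; ≤-<-trans)
open import Data.Nat.Induction using (<-wellFounded)
open import Data.Nat.Divisibility using (_∣_; divides; _∣0; ∣-reflexive; ∣m∣n⇒∣m+n)
open import Data.Nat.DivMod using ([m+kn]%n≡m%n; m<n⇒m%n≡m)
open import Data.Nat.Tactic.RingSolver using (solve-∀)
open import Data.Product using (_×_; _,_; proj₁; proj₂; ∃₂)
import Data.Product as Product
open import Data.Product.Properties using () renaming (≡-dec to ×-≡-dec)
open import Data.Sum using (_⊎_; inj₁; inj₂)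
open import Data.List using (List; []; _∷_; _++_; length; filter; map; concatMap; cartesianProduct)
open import Data.List.Properties using (filter-notAll; length-map; ∷-injectiveʳ) renaming (≡-dec to List-≡-dec)
open import Data.List.Relation.Unary.Any using (here; there)
open import Data.List.Relation.Unary.All as All using (All; []; _∷_)
import Data.List.Relation.Unary.All.Properties as All
open import Data.List.Relation.Unary.AllPairs using (AllPairs; []; _∷_)
open import Data.List.Relation.Unary.Unique.Propositional using (Unique)
import Data.List.Relation.Unary.Unique.Propositional.Properties as Unique
open import Data.List.Membership.Propositional using (_∈_; _∉_)
open import Data.List.Membership.Propositional.Properties
  using (∈-filter⁺; ∈-filter⁻; ∈-++⁺ˡ; ∈-++⁺ʳ; ∈-++⁻; ∈-map⁺; ∈-map⁻; ∈-cartesianProduct⁺; ∈-cartesianProduct⁻)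
open import Data.List.Membership.Propositional.Properties.WithK using (unique∧set⇒bag)
import Data.List.Membership.DecPropositional as DecMembership
open import Data.List.Relation.Binary.BagAndSetEquality using (_∼[_]_; set; ∼bag⇒↭)
open import Data.List.Relation.Binary.Disjoint.Propositional using (Disjoint)
open import Data.List.Relation.Binary.Permutation.Propositional.Properties using (↭-length)
open import Data.List.Relation.Binary.Sublist.Propositional using (_⊆_; []; _∷_; _∷ʳ_; lookup)
open import Data.List.Relation.Binary.Sublist.Propositional.Properties using (All-resp-⊆; filter-⊆)
open import Induction.WellFounded using (Acc; acc)
open import Relation.Binary.Core using (Rel)
open import Relation.Binary.Definitions using (DecidableEquality; Symmetric)
open import Relation.Binary.PropositionalEquality
  using (_≡_; _≢_; refl; sym; trans; cong; cong₂; subst; subst₂; ≢-sym; module ≡-Reasoning)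
open import Relation.Nullary using (¬_; yes; no; contradiction)
open import Relation.Nullary.Decidable using (_×-dec_; decidable-stable)
open import Relation.Unary using (Pred; Decidable)
open import Relation.Unary.Properties using (∁?)

open ≡-Reasoning

module _ {A : Set} where

  length-filter-∁ : {P : Pred A 0ℓ} (P? : Decidable P) (xs : List A) →
                    length (filter P? xs) + length (filter (∁? P?) xs) ≡ length xs
  length-filter-∁ P? []       = refl
  length-filter-∁ P? (x ∷ xs) with P? x
  ... | yes _ = cong suc (length-filter-∁ P? xs)
  ... | no  _ = trans (+-suc _ _) (cong suc (length-filter-∁ P? xs))

  unique∧set⇒length≡ : {xs ys : List A} → Unique xs → Unique ys → xs ∼[ set ] ys →
                       length xs ≡ length ys
  unique∧set⇒length≡ xs! ys! xs≈ys = ↭-length (∼bag⇒↭ (unique∧set⇒bag xs! ys! xs≈ys))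

  unique-map⁺ : {B : Set} {f : A → B} {xs : List A} →
                (∀ {x y} → x ∈ xs → y ∈ xs → f x ≡ f y → x ≡ y) → Unique xs → Unique (map f xs)
  unique-map⁺ f-inj []           = []
  unique-map⁺ f-inj (x∉xs ∷ xs!) =
    All.map⁺ (All.tabulate λ y∈ → All.lookup x∉xs y∈ ∘ f-inj (here refl) (there y∈))
    ∷ unique-map⁺ (λ x∈ y∈ → f-inj (there x∈) (there y∈)) xs!

  unique∧allEqual⇒length≤1 : {xs : List A} → Unique xs → (∀ {x y} → x ∈ xs → y ∈ xs → x ≡ y) → length xs ≤ 1
  unique∧allEqual⇒length≤1 {[]}        _                 _    = z≤n
  unique∧allEqual⇒length≤1 {_ ∷ []}    _                 _    = s≤s z≤n
  unique∧allEqual⇒length≤1 {_ ∷ _ ∷ _} ((x≢y ∷ _) ∷ _) all≡ =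
    contradiction (all≡ (here refl) (there (here refl))) x≢y

  AllPairs-resp-⊇ : {R : Rel A 0ℓ} {xs ys : List A} → xs ⊆ ys → AllPairs R ys → AllPairs R xs
  AllPairs-resp-⊇ []         []        = []
  AllPairs-resp-⊇ (_ ∷ʳ τ)   (_ ∷ ys)  = AllPairs-resp-⊇ τ ys
  AllPairs-resp-⊇ (refl ∷ τ) (px ∷ ys) = All-resp-⊆ τ px ∷ AllPairs-resp-⊇ τ ys

  allPairs-two : {R : Rel A 0ℓ} {xs : List A} → 2 ≤ length xs → AllPairs R xs →
                 ∃₂ λ x y → x ∈ xs × y ∈ xs × R x y
  allPairs-two {xs = _ ∷ []}    (s≤s ())
  allPairs-two {xs = x ∷ y ∷ _} _ ((Rxy ∷ _) ∷ _) = x , y , here refl , there (here refl) , Rxy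

  allPairs-lookup : {R : Rel A 0ℓ} {xs : List A} {x y : A} → Symmetric R →
                    AllPairs R xs → x ∈ xs → y ∈ xs → x ≢ y → R x y
  allPairs-lookup R-sym (_  ∷ _)  (here refl) (here refl) x≢y = contradiction refl x≢y
  allPairs-lookup R-sym (px ∷ _)  (here refl) (there y∈)  _   = All.lookup px y∈
  allPairs-lookup R-sym (px ∷ _)  (there x∈)  (here refl) _   = R-sym (All.lookup px x∈)
  allPairs-lookup R-sym (_  ∷ xs) (there x∈)  (there y∈)  x≢y = allPairs-lookup R-sym xs x∈ y∈ x≢y

  allPairs-tabulate : {R : Rel A 0ℓ} {xs : List A} → Unique xs →
                      (∀ {x y} → x ∈ xs → y ∈ xs → x ≢ y → R x y) → AllPairs R xs
  allPairs-tabulate []           R-pairs = []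
  allPairs-tabulate (x∉xs ∷ xs!) R-pairs =
    All.tabulate (λ y∈ → R-pairs (here refl) (there y∈) (All.lookup x∉xs y∈))
    ∷ allPairs-tabulate xs! (λ x∈ y∈ → R-pairs (there x∈) (there y∈))

  ⊆-ext : {xs S T : List A} → Unique xs → S ⊆ xs → T ⊆ xs → S ∼[ set ] T → S ≡ T
  ⊆-ext xs! τ σ S≈T = go xs! τ σ (Equivalence.to S≈T) (Equivalence.from S≈T)
    where
    fresh : {y : A} {xs S : List A} → All (y ≢_) xs → S ⊆ xs → y ∉ S
    fresh y∉xs τ y∈S = All.lookup y∉xs (lookup τ y∈S) refl

    drop : {y : A} {S T : List A} → y ∉ S → (∀ {c} → c ∈ S → c ∈ y ∷ T) → ∀ {c} → c ∈ S → c ∈ T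
    drop y∉S S⊆yT c∈S with S⊆yT c∈S
    ... | here refl = contradiction c∈S y∉S
    ... | there c∈T = c∈T

    go : {xs S T : List A} → Unique xs → S ⊆ xs → T ⊆ xs →
         (∀ {c} → c ∈ S → c ∈ T) → (∀ {c} → c ∈ T → c ∈ S) → S ≡ T
    go _            []         []         _   _   = refl
    go (_    ∷ xs!) (_ ∷ʳ τ)   (_ ∷ʳ σ)   S⊆T T⊆S = go xs! τ σ S⊆T T⊆S
    go (y∉xs ∷ _)   (_ ∷ʳ τ)   (refl ∷ _) _   T⊆S = contradiction (T⊆S (here refl)) (fresh y∉xs τ)
    go (y∉xs ∷ _)   (refl ∷ _) (_ ∷ʳ σ)   S⊆T _   = contradiction (S⊆T (here refl)) (fresh y∉xs σ)
    go (y∉xs ∷ xs!) (refl ∷ τ) (refl ∷ σ) S⊆T T⊆S =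
      cong (_ ∷_) (go xs! τ σ (drop (fresh y∉xs τ) (S⊆T ∘ there)) (drop (fresh y∉xs σ) (T⊆S ∘ there)))

  ∈-subsets⁺ : {xs S : List A} → S ⊆ xs → S ∈ subsets xs
  ∈-subsets⁺ []                    = here refl
  ∈-subsets⁺ {x ∷ xs} (_ ∷ʳ τ)   = ∈-++⁺ˡ (∈-subsets⁺ τ)
  ∈-subsets⁺ {x ∷ xs} (refl ∷ τ) = ∈-++⁺ʳ (subsets xs) (∈-map⁺ (x ∷_) (∈-subsets⁺ τ))

  ∈-subsets⁻ : (xs : List A) {S : List A} → S ∈ subsets xs → S ⊆ xs
  ∈-subsets⁻ []       (here refl) = []
  ∈-subsets⁻ (x ∷ xs) S∈ with ∈-++⁻ (subsets xs) S∈
  ... | inj₁ S∈ˡ = x ∷ʳ ∈-subsets⁻ xs S∈ˡ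
  ... | inj₂ S∈ʳ with T , T∈ , refl ← ∈-map⁻ (x ∷_) S∈ʳ = refl ∷ ∈-subsets⁻ xs T∈

  unique-subsets : {xs : List A} → Unique xs → Unique (subsets xs)
  unique-subsets []                      = [] ∷ []
  unique-subsets {x ∷ xs} (x∉xs ∷ xs!) =
    Unique.++⁺ subsets! (Unique.map⁺ ∷-injectiveʳ subsets!) disjoint
    where
    subsets! = unique-subsets xs!
    disjoint : Disjoint (subsets xs) (map (x ∷_) (subsets xs))
    disjoint (S∈ , xS∈) with _ , _ , refl ← ∈-map⁻ (x ∷_) xS∈ =
      All.lookup x∉xs (lookup (∈-subsets⁻ xs S∈) (here refl)) refl

-- Counting orbits

record Orbits {A : Set} (orbit : A → List A) (k : ℕ) (L : List A) : Set where
  field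
    closed     : ∀ {x y} → x ∈ L → y ∈ orbit x → y ∈ L
    reflexive  : ∀ {x} → x ∈ L → x ∈ orbit x
    symmetric  : ∀ {x y} → x ∈ L → y ∈ orbit x → x ∈ orbit y
    transitive : ∀ {x y z} → x ∈ L → y ∈ orbit x → z ∈ orbit y → z ∈ orbit x
    unique     : ∀ {x} → x ∈ L → Unique (orbit x)
    size       : ∀ {x} → x ∈ L → length (orbit x) ≡ k

module _ {A : Set} {orbit : A → List A} {k : ℕ} where

  filter-orbits : {L : List A} {P : Pred A 0ℓ} (P? : Decidable P) → Orbits orbit k L →
                  (∀ {x y} → x ∈ L → P x → y ∈ orbit x → P y) → Orbits orbit k (filter P? L)
  filter-orbits {L} P? o P-stable = record
    { closed     = λ x∈ y∈ → ∈-filter⁺ P? (closed (∈L x∈) y∈)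
                                (P-stable (∈L x∈) (proj₂ (∈-filter⁻ P? {xs = L} x∈)) y∈)
    ; reflexive  = reflexive ∘ ∈L
    ; symmetric  = symmetric ∘ ∈L
    ; transitive = transitive ∘ ∈L
    ; unique     = unique ∘ ∈L
    ; size       = size ∘ ∈L
    }
    where
    open Orbits o
    ∈L : ∀ {x} → x ∈ filter P? L → x ∈ L
    ∈L = proj₁ ∘ ∈-filter⁻ P?

  orbits-divide : DecidableEquality A → {L : List A} → Unique L → Orbits orbit k L → k ∣ length L
  orbits-divide _≟ₐ_ {L} = go L (<-wellFounded (length L))
    where
    open DecMembership _≟ₐ_ using (_∈?_)

    go : ∀ L → Acc _<_ (length L) → Unique L → Orbits orbit k L → k ∣ length L
    go []          _         _  _ = k ∣0
    go L@(x ∷ _) (acc rec) L! o =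
      subst (k ∣_) (length-filter-∁ ∈orbit? L)
        (∣m∣n⇒∣m+n (∣-reflexive (sym orbit-count))
                    (go rest (rec rest-shorter) (Unique.filter⁺ (∁? ∈orbit?) L!) rest-orbits))
      where
      open Orbits o
      ∈orbit? : Decidable (_∈ orbit x)
      ∈orbit? y = y ∈? orbit x

      rest : List A
      rest = filter (∁? ∈orbit?) L

      orbit-count : length (filter ∈orbit? L) ≡ k
      orbit-count = trans
        (unique∧set⇒length≡ (Unique.filter⁺ ∈orbit? L!) (unique (here refl))
          (mk⇔ (proj₂ ∘ ∈-filter⁻ ∈orbit?) (λ y∈ → ∈-filter⁺ ∈orbit? (closed (here refl) y∈) y∈)))
        (size (here refl))

      rest-shorter : length rest < length L
      rest-shorter = filter-notAll (∁? ∈orbit?) L (here (λ x∉ → x∉ (reflexive (here refl))))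

      rest-orbits : Orbits orbit k rest
      rest-orbits = filter-orbits (∁? ∈orbit?) o
        (λ y∈L y∉ z∈ z∈ˣ → y∉ (transitive (here refl) z∈ˣ (symmetric y∈L z∈)))

pattern 1st e = here e
pattern 2nd e = there (here e)
pattern 3rd e = there (there (here e))
pattern 4th e = there (there (there (here e)))

unique-4 : {A : Set} {p q r s : A} →
           p ≢ q → p ≢ r → p ≢ s → q ≢ r → q ≢ s → r ≢ s → Unique (p ∷ q ∷ r ∷ s ∷ [])
unique-4 p≢q p≢r p≢s q≢r q≢s r≢s = (p≢q ∷ p≢r ∷ p≢s ∷ []) ∷ (q≢r ∷ q≢s ∷ []) ∷ (r≢s ∷ []) ∷ [] ∷ []

record IsFreeKleinAction {A : Set} (L : List A) (a b : A → A) : Set where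
  field
    a-closed     : ∀ {x} → x ∈ L → a x ∈ L
    b-closed     : ∀ {x} → x ∈ L → b x ∈ L
    a-involutive : ∀ {x} → x ∈ L → a (a x) ≡ x
    b-involutive : ∀ {x} → x ∈ L → b (b x) ≡ x
    commute      : ∀ {x} → x ∈ L → a (b x) ≡ b (a x)
    a-free       : ∀ {x} → x ∈ L → a x ≢ x
    b-free       : ∀ {x} → x ∈ L → b x ≢ x
    ab-free      : ∀ {x} → x ∈ L → a (b x) ≢ x

klein-four-divides : {A : Set} → DecidableEquality A → {L : List A} {a b : A → A} →
                     Unique L → IsFreeKleinAction L a b → 4 ∣ length L
klein-four-divides {A} _≟ₐ_ {L} {a} {b} L! action = orbits-divide _≟ₐ_ L! record
  { closed     = closed
  ; reflexive  = λ _ → 1st refl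
  ; symmetric  = symmetric
  ; transitive = transitive
  ; unique     = unique
  ; size       = λ _ → refl
  }
  where
  open IsFreeKleinAction action

  orbit : A → List A
  orbit x = x ∷ a x ∷ b x ∷ a (b x) ∷ []

  closed : ∀ {x y} → x ∈ L → y ∈ orbit x → y ∈ L
  closed x∈ (1st refl) = x∈
  closed x∈ (2nd refl) = a-closed x∈
  closed x∈ (3rd refl) = b-closed x∈
  closed x∈ (4th refl) = a-closed (b-closed x∈)

  a-step : ∀ {x z} → x ∈ L → z ∈ orbit (a x) → z ∈ orbit x
  a-step x∈ (1st refl) = 2nd refl
  a-step x∈ (2nd refl) = 1st (a-involutive x∈)
  a-step x∈ (3rd refl) = 4th (sym (commute x∈))
  a-step x∈ (4th refl) = 3rd (trans (cong a (sym (commute x∈))) (a-involutive (b-closed x∈)))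

  b-step : ∀ {x z} → x ∈ L → z ∈ orbit (b x) → z ∈ orbit x
  b-step x∈ (1st refl) = 3rd refl
  b-step x∈ (2nd refl) = 4th refl
  b-step x∈ (3rd refl) = 1st (b-involutive x∈)
  b-step x∈ (4th refl) = 2nd (cong a (b-involutive x∈))

  transitive : ∀ {x y z} → x ∈ L → y ∈ orbit x → z ∈ orbit y → z ∈ orbit x
  transitive x∈ (1st refl) z∈ = z∈
  transitive x∈ (2nd refl) z∈ = a-step x∈ z∈
  transitive x∈ (3rd refl) z∈ = b-step x∈ z∈
  transitive x∈ (4th refl) z∈ = b-step x∈ (a-step (b-closed x∈) z∈)

  abab : ∀ {x} → x ∈ L → a (b (a (b x))) ≡ x
  abab x∈ = trans (cong (a ∘ b) (commute x∈)) (trans (cong a (b-involutive (a-closed x∈))) (a-involutive x∈))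

  symmetric : ∀ {x y} → x ∈ L → y ∈ orbit x → x ∈ orbit y
  symmetric x∈ (1st refl) = 1st refl
  symmetric x∈ (2nd refl) = 2nd (sym (a-involutive x∈))
  symmetric x∈ (3rd refl) = 3rd (sym (b-involutive x∈))
  symmetric x∈ (4th refl) = 4th (sym (abab x∈))

  unique : ∀ {x} → x ∈ L → Unique (orbit x)
  unique x∈ = unique-4 (≢-sym (a-free x∈)) (≢-sym (b-free x∈)) (≢-sym (ab-free x∈))
    (λ ax≡bx → ab-free x∈ (trans (cong a (sym ax≡bx)) (a-involutive x∈)))
    (λ ax≡abx → b-free x∈
       (trans (sym (a-involutive (b-closed x∈))) (trans (cong a (sym ax≡abx)) (a-involutive x∈))))
    (λ bx≡abx → a-free (b-closed x∈) (sym bx≡abx))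

record IsFreeCyclicAction {A : Set} (L : List A) (r : A → A) : Set where
  field
    r-closed : ∀ {x} → x ∈ L → r x ∈ L
    order-4  : ∀ {x} → x ∈ L → r (r (r (r x))) ≡ x
    r-free   : ∀ {x} → x ∈ L → r x ≢ x
    r²-free  : ∀ {x} → x ∈ L → r (r x) ≢ x

cyclic-four-divides : {A : Set} → DecidableEquality A → {L : List A} {r : A → A} →
                      Unique L → IsFreeCyclicAction L r → 4 ∣ length L
cyclic-four-divides {A} _≟ₐ_ {L} {r} L! action = orbits-divide _≟ₐ_ L! record
  { closed     = closed
  ; reflexive  = λ _ → 1st refl
  ; symmetric  = symmetric
  ; transitive = transitive
  ; unique     = unique
  ; size       = λ _ → refl
  }
  where
  open IsFreeCyclicAction action

  orbit : A → List A
  orbit x = x ∷ r x ∷ r (r x) ∷ r (r (r x)) ∷ []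

  closed : ∀ {x y} → x ∈ L → y ∈ orbit x → y ∈ L
  closed x∈ (1st refl) = x∈
  closed x∈ (2nd refl) = r-closed x∈
  closed x∈ (3rd refl) = r-closed (r-closed x∈)
  closed x∈ (4th refl) = r-closed (r-closed (r-closed x∈))

  step : ∀ {x z} → x ∈ L → z ∈ orbit (r x) → z ∈ orbit x
  step x∈ (1st refl) = 2nd refl
  step x∈ (2nd refl) = 3rd refl
  step x∈ (3rd refl) = 4th refl
  step x∈ (4th refl) = 1st (order-4 x∈)

  transitive : ∀ {x y z} → x ∈ L → y ∈ orbit x → z ∈ orbit y → z ∈ orbit x
  transitive x∈ (1st refl) z∈ = z∈
  transitive x∈ (2nd refl) z∈ = step x∈ z∈
  transitive x∈ (3rd refl) z∈ = step x∈ (step (r-closed x∈) z∈)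
  transitive x∈ (4th refl) z∈ = step x∈ (step (r-closed x∈) (step (r-closed (r-closed x∈)) z∈))

  symmetric : ∀ {x y} → x ∈ L → y ∈ orbit x → x ∈ orbit y
  symmetric x∈ (1st refl) = 1st refl
  symmetric x∈ (2nd refl) = 4th (sym (order-4 x∈))
  symmetric x∈ (3rd refl) = 3rd (sym (order-4 x∈))
  symmetric x∈ (4th refl) = 2nd (sym (order-4 x∈))

  unique : ∀ {x} → x ∈ L → Unique (orbit x)
  unique x∈ = unique-4 (≢-sym (r-free x∈)) (≢-sym (r²-free x∈))
    (λ x≡r³x → r-free x∈ (trans (cong r x≡r³x) (order-4 x∈)))
    (≢-sym (r-free (r-closed x∈))) (≢-sym (r²-free (r-closed x∈))) (≢-sym (r-free (r-closed (r-closed x∈))))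

-- The board

InRange : ℕ → ℕ → Set
InRange n k = 1 ≤ k × k ≤ n

OnBoard : ℕ → Cell → Set
OnBoard n (i , j) = InRange n i × InRange n j

∈-range⁻ : ∀ {n k} → k ∈ range n → InRange n k
∈-range⁻ {suc n} k∈ with ∈-++⁻ (range n) k∈
... | inj₁ k∈ˡ         = Product.map₂ m≤n⇒m≤1+n (∈-range⁻ k∈ˡ)
... | inj₂ (here refl) = s≤s z≤n , ≤-refl

∈-range⁺ : ∀ {n k} → InRange n k → k ∈ range n
∈-range⁺ {zero}  (s≤s _ , ())
∈-range⁺ {suc n} (1≤k , k≤1+n) with m≤n⇒m<n∨m≡n k≤1+n
... | inj₁ (s≤s k≤n) = ∈-++⁺ˡ (∈-range⁺ (1≤k , k≤n))
... | inj₂ refl      = ∈-++⁺ʳ (range n) (here refl)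

unique-range : ∀ n → Unique (range n)
unique-range zero    = []
unique-range (suc n) =
  Unique.++⁺ (unique-range n) ([] ∷ []) λ { (k∈ , here refl) → 1+n≰n (proj₂ (∈-range⁻ k∈)) }

board≡cartesianProduct : ∀ n → board n ≡ cartesianProduct (range n) (range n)
board≡cartesianProduct n = go (range n)
  where
  go : ∀ rows → concatMap (λ i → map (λ j → (i , j)) (range n)) rows ≡ cartesianProduct rows (range n)
  go []         = refl
  go (i ∷ rows) = cong (map (i ,_) (range n) ++_) (go rows)

∈-board⁻ : ∀ {n c} → c ∈ board n → OnBoard n c
∈-board⁻ {n} c∈ = Product.map ∈-range⁻ ∈-range⁻
  (∈-cartesianProduct⁻ (range n) (range n) (subst (_ ∈_) (board≡cartesianProduct n) c∈))

∈-board⁺ : ∀ {n c} → OnBoard n c → c ∈ board n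
∈-board⁺ {n} (i-in , j-in) =
  subst (_ ∈_) (sym (board≡cartesianProduct n)) (∈-cartesianProduct⁺ (∈-range⁺ i-in) (∈-range⁺ j-in))

unique-board : ∀ n → Unique (board n)
unique-board n = subst Unique (sym (board≡cartesianProduct n))
  (Unique.cartesianProduct⁺ (unique-range n) (unique-range n))

m+m≡n+n⇒m≡n : ∀ {m n} → m + m ≡ n + n → m ≡ n
m+m≡n+n⇒m≡n {m} {n} eq = *-cancelˡ-≡ m n 2 (begin
  2 * m     ≡⟨ cong (m +_) (+-identityʳ m) ⟩
  m + m     ≡⟨ eq ⟩
  n + n     ≡⟨ cong (n +_) (+-identityʳ n) ⟨
  2 * n     ∎)

mirror : ℕ → ℕ → ℕ
mirror n k = suc n ∸ k

module _ {n : ℕ} where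

  mirror-inRange : ∀ {k} → InRange n k → InRange n (mirror n k)
  mirror-inRange {suc k} (_ , k<n) = m<n⇒0<n∸m k<n , m∸n≤m n k

  mirror-involutive : ∀ {k} → InRange n k → mirror n (mirror n k) ≡ k
  mirror-involutive (_ , k≤n) = m∸[m∸n]≡n (m≤n⇒m≤1+n k≤n)

  mirror-injective : ∀ {k l} → InRange n k → InRange n l → mirror n k ≡ mirror n l → k ≡ l
  mirror-injective k-in l-in eq =
    trans (sym (mirror-involutive k-in)) (trans (cong (mirror n) eq) (mirror-involutive l-in))

  mirror-fixed-unique : ∀ {k l} → InRange n k → InRange n l → mirror n k ≡ k → mirror n l ≡ l → k ≡ l
  mirror-fixed-unique k-in l-in k-fixed l-fixed =
    m+m≡n+n⇒m≡n (trans (double k-in k-fixed) (sym (double l-in l-fixed)))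
    where
    double : ∀ {k} → InRange n k → mirror n k ≡ k → k + k ≡ suc n
    double {k} (_ , k≤n) fixed = trans (cong (_+ k) (sym fixed)) (m∸n+n≡m (m≤n⇒m≤1+n k≤n))

[m∸a]+x≡[m∸b]+y⇒b+x≡a+y : ∀ {m a b x y} → a ≤ m → b ≤ m → (m ∸ a) + x ≡ (m ∸ b) + y → b + x ≡ a + y
[m∸a]+x≡[m∸b]+y⇒b+x≡a+y {m} {a} {b} {x} {y} a≤m b≤m eq = +-cancelˡ-≡ m (b + x) (a + y) (begin
  m + (b + x)               ≡⟨ cong (_+ (b + x)) (m∸n+n≡m a≤m) ⟨
  (m ∸ a) + a + (b + x)     ≡⟨ shuffle (m ∸ a) a b x ⟩
  (m ∸ a) + x + (a + b)     ≡⟨ cong (_+ (a + b)) eq ⟩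
  (m ∸ b) + y + (a + b)     ≡⟨ cong ((m ∸ b) + y +_) (+-comm a b) ⟩
  (m ∸ b) + y + (b + a)     ≡⟨ shuffle (m ∸ b) b a y ⟨
  (m ∸ b) + b + (a + y)     ≡⟨ cong (_+ (a + y)) (m∸n+n≡m b≤m) ⟩
  m + (a + y)               ∎)
  where
  shuffle : ∀ u v w t → u + v + (w + t) ≡ u + t + (v + w)
  shuffle = solve-∀

mirror-swap : ∀ {n a b x y} → InRange n a → InRange n b → mirror n a + x ≡ mirror n b + y → b + x ≡ a + y
mirror-swap (_ , a≤n) (_ , b≤n) = [m∸a]+x≡[m∸b]+y⇒b+x≡a+y (m≤n⇒m≤1+n a≤n) (m≤n⇒m≤1+n b≤n)

-- Symmetries of the board

NonAttacking-sym : Symmetric NonAttacking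
NonAttacking-sym (i≢i' , j≢j' , diag≢ , anti≢) = i≢i' ∘ sym , j≢j' ∘ sym , diag≢ ∘ sym , anti≢ ∘ sym

_≟ᶜ_ : DecidableEquality Cell
_≟ᶜ_ = ×-≡-dec _≟_ _≟_

_≟ˢ_ : DecidableEquality (List Cell)
_≟ˢ_ = List-≡-dec _≟ᶜ_

open DecMembership _≟ᶜ_ using (_∈?_)

transpose : Cell → Cell
transpose (i , j) = (j , i)

transpose-nonAttacking : ∀ {c d} → NonAttacking c d → NonAttacking (transpose c) (transpose d)
transpose-nonAttacking {i , j} {i' , j'} (i≢i' , j≢j' , diag≢ , anti≢) =
  j≢j' , i≢i' ,
  (λ eq → diag≢ (trans (+-comm j i') (trans (sym eq) (+-comm i j')))) ,
  (λ eq → anti≢ (trans (+-comm i j) (trans eq (+-comm j' i'))))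

module _ (n : ℕ) where

  flipColumns flipRows rotate180 rotate90 : Cell → Cell
  flipColumns (i , j) = (i , mirror n j)
  flipRows    (i , j) = (mirror n i , j)
  rotate180 = flipRows ∘ flipColumns
  rotate90  = transpose ∘ flipColumns

  MapsBoard : (Cell → Cell) → Set
  MapsBoard g = ∀ {c} → OnBoard n c → OnBoard n (g c)

  flipColumns-onBoard : MapsBoard flipColumns
  flipColumns-onBoard = Product.map₂ mirror-inRange

  flipRows-onBoard : MapsBoard flipRows
  flipRows-onBoard = Product.map₁ mirror-inRange

  transpose-onBoard : MapsBoard transpose
  transpose-onBoard = Product.swap

  rotate180-onBoard : MapsBoard rotate180
  rotate180-onBoard = flipRows-onBoard ∘ flipColumns-onBoard

  rotate90-onBoard : MapsBoard rotate90
  rotate90-onBoard = transpose-onBoard ∘ flipColumns-onBoard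

  record IsBoardInvolution (g : Cell → Cell) : Set where
    field
      onBoard      : MapsBoard g
      involutive   : ∀ {c} → OnBoard n c → g (g c) ≡ c
      nonAttacking : ∀ {c d} → OnBoard n c → OnBoard n d → NonAttacking c d → NonAttacking (g c) (g d)

    injective : ∀ {c d} → OnBoard n c → OnBoard n d → g c ≡ g d → c ≡ d
    injective c-on d-on eq = trans (sym (involutive c-on)) (trans (cong g eq) (involutive d-on))

  flipColumns-involution : IsBoardInvolution flipColumns
  flipColumns-involution = record
    { onBoard      = flipColumns-onBoard
    ; involutive   = λ { {i , j} (_ , j-in) → cong (i ,_) (mirror-involutive j-in) }
    ; nonAttacking = nonAttacking
    }
    where
    nonAttacking : ∀ {c d} → OnBoard n c → OnBoard n d → NonAttacking c d →
                   NonAttacking (flipColumns c) (flipColumns d)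
    nonAttacking {i , j} {i' , j'} (_ , j-in) (_ , j'-in) (i≢i' , j≢j' , diag≢ , anti≢) =
      i≢i' , j≢j' ∘ mirror-injective j-in j'-in ,
      (λ eq → anti≢ (trans (+-comm i j) (trans (sym (mirror-swap j-in j'-in eq)) (+-comm j' i')))) ,
      (λ eq → diag≢ (sym (mirror-swap j-in j'-in
                (trans (+-comm (mirror n j) i) (trans eq (+-comm i' (mirror n j')))))))

  flipRows-involution : IsBoardInvolution flipRows
  flipRows-involution = record
    { onBoard      = flipRows-onBoard
    ; involutive   = λ { {i , j} (i-in , _) → cong (_, j) (mirror-involutive i-in) }
    ; nonAttacking = nonAttacking
    }
    where
    nonAttacking : ∀ {c d} → OnBoard n c → OnBoard n d → NonAttacking c d →
                   NonAttacking (flipRows c) (flipRows d)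
    nonAttacking {i , j} {i' , j'} (i-in , _) (i'-in , _) (i≢i' , j≢j' , diag≢ , anti≢) =
      i≢i' ∘ mirror-injective i-in i'-in , j≢j' ,
      (λ eq → anti≢ (mirror-swap i'-in i-in
                (trans (+-comm (mirror n i') j) (trans eq (+-comm j' (mirror n i)))))) ,
      (λ eq → diag≢ (trans (+-comm j i') (trans (mirror-swap i-in i'-in eq) (+-comm i j'))))

  transpose-involution : IsBoardInvolution transpose
  transpose-involution = record
    { onBoard      = transpose-onBoard
    ; involutive   = λ _ → refl
    ; nonAttacking = λ _ _ → transpose-nonAttacking
    }

  ⊆-board⇒unique : ∀ {S} → S ⊆ board n → Unique S
  ⊆-board⇒unique S⊆ = AllPairs-resp-⊇ S⊆ (unique-board n)

  ⊆-board⇒onBoard : ∀ {S c} → S ⊆ board n → c ∈ S → OnBoard n c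
  ⊆-board⇒onBoard S⊆ = ∈-board⁻ ∘ lookup S⊆

  -- g⁻¹(S) listed in board order, which is the image of S when g is an involution.  Keeping every
  -- set of cells a sublist of the board makes equal sets equal lists (⊆-ext).
  preimage : (Cell → Cell) → List Cell → List Cell
  preimage g S = filter (λ c → g c ∈? S) (board n)

  module _ {g : Cell → Cell} {S : List Cell} where

    preimage-⊆ : preimage g S ⊆ board n
    preimage-⊆ = filter-⊆ (λ c → g c ∈? S) (board n)

    unique-preimage : Unique (preimage g S)
    unique-preimage = Unique.filter⁺ (λ c → g c ∈? S) (unique-board n)

    ∈-preimage⁻ : ∀ {c} → c ∈ preimage g S → OnBoard n c × g c ∈ S
    ∈-preimage⁻ = Product.map₁ ∈-board⁻ ∘ ∈-filter⁻ (λ c → g c ∈? S) {xs = board n}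

    ∈-preimage⁺ : ∀ {c} → OnBoard n c → g c ∈ S → c ∈ preimage g S
    ∈-preimage⁺ c-on = ∈-filter⁺ (λ c → g c ∈? S) (∈-board⁺ c-on)

  preimage-ext : ∀ {g h S T} → (∀ {c} → OnBoard n c → g c ∈ S → h c ∈ T) →
                 (∀ {c} → OnBoard n c → h c ∈ T → g c ∈ S) → preimage g S ≡ preimage h T
  preimage-ext to from = ⊆-ext (unique-board n) preimage-⊆ preimage-⊆ (mk⇔ (transport to) (transport from))
    where
    transport : ∀ {g h S T} → (∀ {c} → OnBoard n c → g c ∈ S → h c ∈ T) →
                ∀ {c} → c ∈ preimage g S → c ∈ preimage h T
    transport g⇒h c∈ = let c-on , gc∈ = ∈-preimage⁻ c∈ in ∈-preimage⁺ c-on (g⇒h c-on gc∈)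

  preimage-cong : ∀ {g h S} → (∀ {c} → OnBoard n c → g c ≡ h c) → preimage g S ≡ preimage h S
  preimage-cong {S = S} g≗h =
    preimage-ext (λ c-on → subst (_∈ S) (g≗h c-on)) (λ c-on → subst (_∈ S) (sym (g≗h c-on)))

  preimage-∘ : ∀ {g h S} → MapsBoard g →
               preimage g (preimage h S) ≡ preimage (h ∘ g) S
  preimage-∘ g-on = preimage-ext (λ _ gc∈ → proj₂ (∈-preimage⁻ gc∈)) (λ c-on → ∈-preimage⁺ (g-on c-on))

  preimage-id : ∀ {S} → S ⊆ board n → preimage id S ≡ S
  preimage-id S⊆ = ⊆-ext (unique-board n) preimage-⊆ S⊆
    (mk⇔ (proj₂ ∘ ∈-preimage⁻) (λ c∈ → ∈-preimage⁺ (⊆-board⇒onBoard S⊆ c∈) c∈))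

  preimage-comm : ∀ {g h S} → MapsBoard g → MapsBoard h → (∀ {c} → OnBoard n c → g (h c) ≡ h (g c)) →
                  preimage g (preimage h S) ≡ preimage h (preimage g S)
  preimage-comm {g} {h} {S} g-on h-on commute = begin
    preimage g (preimage h S) ≡⟨ preimage-∘ g-on ⟩
    preimage (h ∘ g) S        ≡⟨ preimage-cong (sym ∘ commute) ⟩
    preimage (g ∘ h) S        ≡⟨ preimage-∘ h-on ⟨
    preimage h (preimage g S) ∎

  module _ {g : Cell → Cell} (g-inv : IsBoardInvolution g) {S : List Cell} (S⊆ : S ⊆ board n) where
    open IsBoardInvolution g-inv

    preimage-involutive : preimage g (preimage g S) ≡ S
    preimage-involutive = trans (preimage-∘ onBoard) (trans (preimage-cong involutive) (preimage-id S⊆))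

    length-preimage : length (preimage g S) ≡ length S
    length-preimage = begin
      length (preimage g S) ≡⟨ unique∧set⇒length≡ unique-preimage
                                 (unique-map⁺ injectiveˢ (⊆-board⇒unique S⊆)) (mk⇔ to from) ⟩
      length (map g S)      ≡⟨ length-map g S ⟩
      length S              ∎
      where
      onBoardˢ : ∀ {c} → c ∈ S → OnBoard n c
      onBoardˢ = ⊆-board⇒onBoard S⊆

      injectiveˢ : ∀ {c d} → c ∈ S → d ∈ S → g c ≡ g d → c ≡ d
      injectiveˢ c∈ d∈ = injective (onBoardˢ c∈) (onBoardˢ d∈)

      to : ∀ {c} → c ∈ preimage g S → c ∈ map g S
      to c∈ = let c-on , gc∈ = ∈-preimage⁻ c∈ in subst (_∈ map g S) (involutive c-on) (∈-map⁺ g gc∈)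

      from : ∀ {c} → c ∈ map g S → c ∈ preimage g S
      from c∈ with s , s∈ , refl ← ∈-map⁻ g c∈ =
        ∈-preimage⁺ (onBoard (onBoardˢ s∈)) (subst (_∈ S) (sym (involutive (onBoardˢ s∈))) s∈)

    preimage-queens : IsQueens n S → IsQueens n (preimage g S)
    preimage-queens (S-length , S-nonAttacking) =
      trans length-preimage S-length , allPairs-tabulate unique-preimage pairs
      where
      pairs : ∀ {c d} → c ∈ preimage g S → d ∈ preimage g S → c ≢ d → NonAttacking c d
      pairs c∈ d∈ c≢d =
        let c-on , gc∈ = ∈-preimage⁻ c∈
            d-on , gd∈ = ∈-preimage⁻ d∈
        in subst₂ NonAttacking (involutive c-on) (involutive d-on)
             (nonAttacking (onBoard c-on) (onBoard d-on)
               (allPairs-lookup NonAttacking-sym S-nonAttacking gc∈ gd∈ (c≢d ∘ injective c-on d-on)))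

  configurations : List (List Cell)
  configurations = filter (isQueens? n) (subsets (board n))

  unique-configurations : Unique configurations
  unique-configurations = Unique.filter⁺ (isQueens? n) (unique-subsets (unique-board n))

  ∈-configurations⁻ : ∀ {S} → S ∈ configurations → S ⊆ board n × IsQueens n S
  ∈-configurations⁻ = Product.map₁ (∈-subsets⁻ (board n)) ∘ ∈-filter⁻ (isQueens? n) {xs = subsets (board n)}

  preimage-configuration : ∀ {g S} → IsBoardInvolution g → S ∈ configurations → preimage g S ∈ configurations
  preimage-configuration g-inv S∈ =
    let S⊆ , S-queens = ∈-configurations⁻ S∈
    in ∈-filter⁺ (isQueens? n) (∈-subsets⁺ preimage-⊆) (preimage-queens g-inv S⊆ S-queens)

  no-invariant-configuration : 2 ≤ n → ∀ {g} → (∀ c → ¬ NonAttacking c (g c)) →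
    (∀ {c d} → OnBoard n c → OnBoard n d → g c ≡ c → g d ≡ d → ¬ NonAttacking c d) →
    ∀ {S} → S ⊆ board n → IsQueens n S → preimage g S ≢ S
  no-invariant-configuration 2≤n {g} attacks-image fixed-attack {S} S⊆ (S-length , S-nonAttacking) invariant
    with c , d , c∈ , d∈ , c-d ← allPairs-two (subst (2 ≤_) (sym S-length) 2≤n) S-nonAttacking =
    fixed-attack (⊆-board⇒onBoard S⊆ c∈) (⊆-board⇒onBoard S⊆ d∈) (fixes c∈) (fixes d∈) c-d
    where
    -- g q is again a queen, and it attacks q unless it is q.
    fixes : ∀ {q} → q ∈ S → g q ≡ q
    fixes {q} q∈ = decidable-stable (g q ≟ᶜ q) λ gq≢q →
      attacks-image q (allPairs-lookup NonAttacking-sym S-nonAttacking q∈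
        (proj₂ (∈-preimage⁻ (subst (q ∈_) (sym invariant) q∈))) (≢-sym gq≢q))

  flipColumns-no-invariant : 2 ≤ n → ∀ {S} → S ⊆ board n → IsQueens n S → preimage flipColumns S ≢ S
  flipColumns-no-invariant 2≤n = no-invariant-configuration 2≤n
    (λ { (i , j) (i≢i , _) → i≢i refl })
    (λ { (_ , j-in) (_ , j'-in) c-fixed d-fixed (_ , j≢j' , _) →
         j≢j' (mirror-fixed-unique j-in j'-in (cong proj₂ c-fixed) (cong proj₂ d-fixed)) })

  flipRows-no-invariant : 2 ≤ n → ∀ {S} → S ⊆ board n → IsQueens n S → preimage flipRows S ≢ S
  flipRows-no-invariant 2≤n = no-invariant-configuration 2≤n
    (λ { (i , j) (_ , j≢j , _) → j≢j refl })
    (λ { (i-in , _) (i'-in , _) c-fixed d-fixed (i≢i' , _) →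
         i≢i' (mirror-fixed-unique i-in i'-in (cong proj₁ c-fixed) (cong proj₁ d-fixed)) })

  transpose-no-invariant : 2 ≤ n → ∀ {S} → S ⊆ board n → IsQueens n S → preimage transpose S ≢ S
  transpose-no-invariant 2≤n = no-invariant-configuration 2≤n
    (λ { (i , j) (_ , _ , _ , anti≢) → anti≢ (+-comm i j) })
    (λ { {i , j} {i' , j'} _ _ c-fixed d-fixed (_ , _ , diag≢ , _) →
         diag≢ (trans (cong (_+ i') (cong proj₁ c-fixed))
                 (trans (+-comm i i') (cong (_+ i) (sym (cong proj₁ d-fixed))))) })

  Centre : Cell → Set
  Centre (i , j) = mirror n i ≡ i × mirror n j ≡ j

  centre? : Decidable Centre
  centre? (i , j) = (mirror n i ≟ i) ×-dec (mirror n j ≟ j)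

  rotate90-free : ∀ {S} → S ⊆ board n → preimage rotate90 S ≡ S →
                  IsFreeCyclicAction (filter (∁? centre?) S) rotate90
  rotate90-free {S} S⊆ invariant = record
    { r-closed = r-closed
    ; order-4  = λ x∈ → order-4 (onBoardʳ x∈)
    ; r-free   = λ x∈ → proj₂ (∈-filter⁻ (∁? centre?) {xs = S} x∈) ∘ r-fixed⇒centre
    ; r²-free  = λ x∈ → proj₂ (∈-filter⁻ (∁? centre?) {xs = S} x∈) ∘ r²-fixed⇒centre
    }
    where
    onBoardʳ : ∀ {c} → c ∈ filter (∁? centre?) S → OnBoard n c
    onBoardʳ = ⊆-board⇒onBoard S⊆ ∘ proj₁ ∘ ∈-filter⁻ (∁? centre?) {xs = S}

    r-closed : ∀ {c} → c ∈ filter (∁? centre?) S → rotate90 c ∈ filter (∁? centre?) S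
    r-closed {i , j} c∈ =
      let c∈S , ¬centre = ∈-filter⁻ (∁? centre?) {xs = S} c∈
          _ , j-in = ⊆-board⇒onBoard S⊆ c∈S
      in ∈-filter⁺ (∁? centre?) (proj₂ (∈-preimage⁻ (subst ((i , j) ∈_) (sym invariant) c∈S)))
           (λ (mmj≡mj , mi≡i) → ¬centre (mi≡i , trans (sym mmj≡mj) (mirror-involutive j-in)))

    order-4 : ∀ {c} → OnBoard n c → rotate90 (rotate90 (rotate90 (rotate90 c))) ≡ c
    order-4 (i-in , j-in) = cong₂ _,_ (mirror-involutive i-in) (mirror-involutive j-in)

    r-fixed⇒centre : ∀ {c} → rotate90 c ≡ c → Centre c
    r-fixed⇒centre fixed = let mj≡i = cong proj₁ fixed ; i≡j = cong proj₂ fixed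
                           in trans (cong (mirror n) i≡j) mj≡i , trans mj≡i i≡j

    r²-fixed⇒centre : ∀ {c} → rotate90 (rotate90 c) ≡ c → Centre c
    r²-fixed⇒centre fixed = cong proj₁ fixed , cong proj₂ fixed

  centre-unique : ∀ {c d} → OnBoard n c → OnBoard n d → Centre c → Centre d → c ≡ d
  centre-unique (i-in , j-in) (i'-in , j'-in) (i-fixed , j-fixed) (i'-fixed , j'-fixed) =
    cong₂ _,_ (mirror-fixed-unique i-in i'-in i-fixed i'-fixed) (mirror-fixed-unique j-in j'-in j-fixed j'-fixed)

  rotate90-invariant-length : ∀ {S} → S ⊆ board n → preimage rotate90 S ≡ S → length S % 4 ≤ 1
  rotate90-invariant-length {S} S⊆ invariant
    with divides q rest≡q*4 ← cyclic-four-divides _≟ᶜ_ (Unique.filter⁺ (∁? centre?) (⊆-board⇒unique S⊆))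
                                                     (rotate90-free S⊆ invariant) =
    subst (_≤ 1) (sym length%4≡centres) centres≤1
    where
    centres : ℕ
    centres = length (filter centre? S)

    centres≤1 : centres ≤ 1
    centres≤1 = unique∧allEqual⇒length≤1 (Unique.filter⁺ centre? (⊆-board⇒unique S⊆)) λ c∈ d∈ →
      let c∈S , c-centre = ∈-filter⁻ centre? {xs = S} c∈
          d∈S , d-centre = ∈-filter⁻ centre? {xs = S} d∈
      in centre-unique (⊆-board⇒onBoard S⊆ c∈S) (⊆-board⇒onBoard S⊆ d∈S) c-centre d-centre

    length%4≡centres : length S % 4 ≡ centres
    length%4≡centres = begin
      length S % 4                                         ≡⟨ cong (_% 4) (length-filter-∁ centre? S) ⟨
      (centres + length (filter (∁? centre?) S)) % 4       ≡⟨ cong (λ m → (centres + m) % 4) rest≡q*4 ⟩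
      (centres + q * 4) % 4                                ≡⟨ [m+kn]%n≡m%n centres q 4 ⟩
      centres % 4                                          ≡⟨ m<n⇒m%n≡m (≤-<-trans centres≤1 (s≤s (s≤s z≤n))) ⟩
      centres                                              ∎

  Centrosymmetric : Pred (List Cell) 0ℓ
  Centrosymmetric S = preimage rotate180 S ≡ S

  centrosymmetric? : Decidable Centrosymmetric
  centrosymmetric? S = preimage rotate180 S ≟ˢ S

  centrosymmetric-configurations noncentrosymmetric-configurations : List (List Cell)
  centrosymmetric-configurations    = filter centrosymmetric? configurations
  noncentrosymmetric-configurations = filter (∁? centrosymmetric?) configurations

  module _ {g : Cell → Cell} (g-inv : IsBoardInvolution g)
           (g-rotate180 : ∀ {c} → OnBoard n c → g (rotate180 c) ≡ rotate180 (g c)) where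
    open IsBoardInvolution g-inv

    preimage-centrosymmetric : ∀ {S} → Centrosymmetric S → Centrosymmetric (preimage g S)
    preimage-centrosymmetric S-centro =
      trans (preimage-comm rotate180-onBoard onBoard (sym ∘ g-rotate180)) (cong (preimage g) S-centro)

    centrosymmetric-closed : ∀ {S} → S ∈ centrosymmetric-configurations →
                             preimage g S ∈ centrosymmetric-configurations
    centrosymmetric-closed S∈ =
      let S∈C , S-centro = ∈-filter⁻ centrosymmetric? {xs = configurations} S∈
      in ∈-filter⁺ centrosymmetric? (preimage-configuration g-inv S∈C) (preimage-centrosymmetric S-centro)

    noncentrosymmetric-closed : ∀ {S} → S ∈ noncentrosymmetric-configurations →
                                preimage g S ∈ noncentrosymmetric-configurations
    noncentrosymmetric-closed S∈ =
      let S∈C , S-noncentro = ∈-filter⁻ (∁? centrosymmetric?) {xs = configurations} S∈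
      in ∈-filter⁺ (∁? centrosymmetric?) (preimage-configuration g-inv S∈C) λ gS-centro →
           S-noncentro (subst Centrosymmetric (preimage-involutive g-inv (proj₁ (∈-configurations⁻ S∈C)))
                                              (preimage-centrosymmetric gS-centro))

  flipColumns-transpose-commute : ∀ {S} → Centrosymmetric S →
    preimage flipColumns (preimage transpose S) ≡ preimage transpose (preimage flipColumns S)
  flipColumns-transpose-commute {S} S-centro = begin
    preimage flipColumns (preimage transpose S)  ≡⟨ preimage-∘ flipColumns-onBoard ⟩
    preimage rotate90 S                          ≡⟨ cong (preimage rotate90) S-centro ⟨
    preimage rotate90 (preimage rotate180 S)     ≡⟨ preimage-∘ rotate90-onBoard ⟩
    preimage (rotate180 ∘ rotate90) S            ≡⟨ preimage-cong rotate180∘rotate90≗flipColumns∘transpose ⟩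
    preimage (flipColumns ∘ transpose) S         ≡⟨ preimage-∘ transpose-onBoard ⟨
    preimage transpose (preimage flipColumns S)  ∎
    where
    rotate180∘rotate90≗flipColumns∘transpose : ∀ {c} → OnBoard n c → rotate180 (rotate90 c) ≡ flipColumns (transpose c)
    rotate180∘rotate90≗flipColumns∘transpose {i , _} (_ , j-in) = cong (_, mirror n i) (mirror-involutive j-in)

  noncentrosymmetric-action : 2 ≤ n →
    IsFreeKleinAction noncentrosymmetric-configurations (preimage flipColumns) (preimage flipRows)
  noncentrosymmetric-action 2≤n = record
    { a-closed     = noncentrosymmetric-closed flipColumns-involution (λ _ → refl)
    ; b-closed     = noncentrosymmetric-closed flipRows-involution (λ _ → refl)
    ; a-involutive = preimage-involutive flipColumns-involution ∘ proj₁ ∘ configuration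
    ; b-involutive = preimage-involutive flipRows-involution ∘ proj₁ ∘ configuration
    ; commute      = λ _ → preimage-comm flipColumns-onBoard flipRows-onBoard (λ _ → refl)
    ; a-free       = λ S∈ → let S⊆ , S-queens = configuration S∈ in flipColumns-no-invariant 2≤n S⊆ S-queens
    ; b-free       = λ S∈ → let S⊆ , S-queens = configuration S∈ in flipRows-no-invariant 2≤n S⊆ S-queens
    ; ab-free      = λ S∈ → proj₂ (∈-filter⁻ (∁? centrosymmetric?) {xs = configurations} S∈)
                            ∘ trans (sym (preimage-∘ flipColumns-onBoard))
    }
    where
    configuration : ∀ {S} → S ∈ noncentrosymmetric-configurations → S ⊆ board n × IsQueens n S
    configuration = ∈-configurations⁻ ∘ proj₁ ∘ ∈-filter⁻ (∁? centrosymmetric?) {xs = configurations}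

  centrosymmetric-action : 2 ≤ n → n % 4 ≡ 2 ⊎ n % 4 ≡ 3 →
    IsFreeKleinAction centrosymmetric-configurations (preimage flipColumns) (preimage transpose)
  centrosymmetric-action 2≤n n%4≡2∨3 = record
    { a-closed     = centrosymmetric-closed flipColumns-involution (λ _ → refl)
    ; b-closed     = centrosymmetric-closed transpose-involution (λ _ → refl)
    ; a-involutive = preimage-involutive flipColumns-involution ∘ proj₁ ∘ configuration
    ; b-involutive = preimage-involutive transpose-involution ∘ proj₁ ∘ configuration
    ; commute      = flipColumns-transpose-commute ∘ proj₂ ∘ ∈-filter⁻ centrosymmetric? {xs = configurations}
    ; a-free       = λ S∈ → let S⊆ , S-queens = configuration S∈ in flipColumns-no-invariant 2≤n S⊆ S-queens
    ; b-free       = λ S∈ → let S⊆ , S-queens = configuration S∈ in transpose-no-invariant 2≤n S⊆ S-queens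
    ; ab-free      = λ S∈ invariant →
        let S⊆ , S-length , _ = configuration S∈
        in %4≡2∨3⇒%4≰1 n n%4≡2∨3 (subst (λ m → m % 4 ≤ 1) S-length
             (rotate90-invariant-length S⊆ (trans (sym (preimage-∘ flipColumns-onBoard)) invariant)))
    }
    where
    configuration : ∀ {S} → S ∈ centrosymmetric-configurations → S ⊆ board n × IsQueens n S
    configuration = ∈-configurations⁻ ∘ proj₁ ∘ ∈-filter⁻ centrosymmetric? {xs = configurations}

    %4≡2∨3⇒%4≰1 : ∀ m → m % 4 ≡ 2 ⊎ m % 4 ≡ 3 → ¬ m % 4 ≤ 1
    %4≡2∨3⇒%4≰1 m (inj₁ eq) rewrite eq = λ { (s≤s ()) }
    %4≡2∨3⇒%4≰1 m (inj₂ eq) rewrite eq = λ { (s≤s ()) }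

lemma5 : (n : ℕ) → n > 0 → (n % 4 ≡ 2 ⊎ n % 4 ≡ 3) → 4 ∣ Q n
lemma5 zero             ()
lemma5 (suc zero)       _  (inj₁ ())
lemma5 (suc zero)       _  (inj₂ ())
lemma5 n@(suc (suc _)) _  n%4≡2∨3 =
  subst (4 ∣_) (length-filter-∁ (centrosymmetric? n) (configurations n))
    (∣m∣n⇒∣m+n
      (klein-four-divides _≟ˢ_ (Unique.filter⁺ (centrosymmetric? n) (unique-configurations n))
                               (centrosymmetric-action n 2≤n n%4≡2∨3))
      (klein-four-divides _≟ˢ_ (Unique.filter⁺ (∁? (centrosymmetric? n)) (unique-configurations n))
                               (noncentrosymmetric-action n 2≤n)))
  where
  2≤n : 2 ≤ n
  2≤n = s≤s (s≤s z≤n)
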